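{- Let $q\equiv3\pmod4$ be a prime power. Then $T=T_0\cup T_0'$, $T_0=T_1\cup T_2$, $T_0'=T_1'\cup T_2'$, $T_1=T_{1,1}\cup T_{1,-1}$ and $T_1'=T'_{1,1}\cup T'_{1,-1}$, and each of these unions is a union of disjoint sets. Both mappings $(x,y)\mapsto(y,x)$ and $(x,y)\mapsto(x^{ -1},y^{ -1})$ permute $T$; both of them exchange $T_1$ and $T_1'$, and exchange $T_2$ and $T_2'$. Furthermore, for each $\varepsilon\in\{ -1,1\}$, $(x,y)\mapsto(y,x)$ maps $T_{1,\varepsilon}$ onto $T'_{1,\varepsilon}$, while $(x,y)\mapsto(x^{ -1},y^{ -1})$ maps $T_{1,\varepsilon}$ onto $T'_{1,-\varepsilon}$.
   Context: Let $\mathbb{F}=\mathbb{F}_q$ and $\chi:\mathbb{F}\to\{ -1,0,1\}$ the quadratic character with $\chi(0)=0$. A square is an element $z^2$, $z\in\mathbb{F}$; a nonsquare is an element that is not a square. $\Sigma$ is the set of $(a,b)\in\mathbb{F}^2$ with $a\ne b$, $a,b\notin\{0,1\}$ and $ab$, $(1-a)(1-b)$ squares. $S$ is the set of $(x,y)\in\mathbb{F}^2$ with $x,y$ squares, $x\ne y$, $\{x,y\}\cap\{0,1\}=\emptyset$. $\Psi:\Sigma\to S$ is $\Psi(a,b)=(a/b,(1-a)/(1-b))$. For $(a,b)\in\Sigma$ let $\psi=\psi_{a,b}$, $\psi(u)=au$ if $u$ is a square and $\psi(u)=bu$ if $u$ is a nonsquare. Let $E(a,b)$ be the set of $(u,v)\in\mathbb{F}^2\setminus\{(0,0)\}$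 with $\psi(\psi(u)-v)=\psi(-v)+\psi(u-v-\psi(-v))$. For $i,j,r,s\in\{0,1\}$, $E_{ij}^{rs}(a,b)$ is the set of $(u,v)\in E(a,b)$ such that: $i=0$ iff $u$ is a square; $j=0$ iff $-v$ is a square; $r=0$ iff $\psi(u)-v$ is a square; $s=0$ iff $u-v-\psi(-v)$ is a square. $\Sigma_{ij}^{rs}=\{(a,b)\in\Sigma:E_{ij}^{rs}(a,b)\ne\emptyset\}$, $S_{ij}^{rs}=\Psi(\Sigma_{ij}^{rs})$, and $T=S\setminus\bigcup_{i,j,r,s\in\{0,1\}}S_{ij}^{rs}$. Define $T_0=\{(x,y)\in T:\chi(y-x)=1\}$, $T_{1,1}=\{(x,y)\in T_0:\chi(1-y)=\chi(1-x)=1\}$, $T_{1,-1}=\{(x,y)\in T_0:\chi(1-y)=\chi(1-x)=-1\}$, $T_2=\{(x,y)\in T_0:\chi(1-x)=-1,\ \chi(1-y)=1\}$, $T_1=T_{1,1}\cup T_{1,-1}$; and define $T_0'$, $T'_{1,1}$, $T'_{1,-1}$, $T_2'$, $T_1'$ in the same way with the roles of $x$ and $y$ exchanged (e.g. $T_0'=\{(x,y)\in T:\chi(x-y)=1\}$, $T_2'=\{(x,y)\in T_0':\chi(1-y)=-1,\ \chi(1-x)=1\}$). -}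

module Defs where

open import Level using (0ℓ)
open import Data.Nat using (ℕ; suc; _^_)
open import Data.Nat.Primality using (Prime)
open import Data.Fin using (Fin)
import Data.Fin.Properties as FinP
open import Data.Integer using (ℤ; +_; -[1+_])
open import Data.Product using (Σ; ∃; _×_; _,_; proj₁; proj₂)
open import Data.Sum using (_⊎_)
open import Data.Empty using (⊥)
open import Relation.Nullary using (¬_; Dec; yes; no)
open import Relation.Binary.PropositionalEquality using (_≡_; _≢_; refl; sym; trans; cong; subst)
open import Algebra.Structures using (IsCommutativeRing)

IsPrimePower : ℕ → Set
IsPrimePower q = Σ ℕ λ p → Σ ℕ λ k → Prime p × q ≡ p ^ suc k

record FiniteField (q : ℕ) : Set₁ where
  infixl 7 _*_
  infixl 6 _+_ _-_
  field
    Carrier : Set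
    _+_ _*_ : Carrier → Carrier → Carrier
    -_ : Carrier → Carrier
    0# 1# : Carrier
    isCommutativeRing : IsCommutativeRing _≡_ _+_ _*_ -_ 0# 1#
    0≢1 : 0# ≢ 1#
    _⁻¹ : Carrier → Carrier
    ⁻¹-inverse : ∀ x → x ≢ 0# → x * (x ⁻¹) ≡ 1#
    enum : Fin q → Carrier
    index : Carrier → Fin q
    enum-index : ∀ x → enum (index x) ≡ x
    index-enum : ∀ i → index (enum i) ≡ i

  _-_ : Carrier → Carrier → Carrier
  x - y = x + (- y)

  _≟_ : (x y : Carrier) → Dec (x ≡ y)
  x ≟ y with index x FinP.≟ index y
  ... | yes e = yes (trans (sym (enum-index x)) (trans (cong enum e) (enum-index y)))
  ... | no ne = no λ e → ne (cong index e)

  IsSquare : Carrier → Set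
  IsSquare x = ∃ λ z → z * z ≡ x

  isSquare? : (x : Carrier) → Dec (IsSquare x)
  isSquare? x with FinP.any? (λ i → (enum i * enum i) ≟ x)
  ... | yes (i , e) = yes (enum i , e)
  ... | no ne = no λ { (z , e) → ne (index z , subst (λ w → w * w ≡ x) (sym (enum-index z)) e) }

  χ : Carrier → ℤ
  χ x with x ≟ 0#
  ... | yes _ = + 0
  ... | no _ with isSquare? x
  ...   | yes _ = + 1
  ...   | no _ = -[1+ 0 ]

  Pair : Set
  Pair = Carrier × Carrier

  InΣ : Pair → Set
  InΣ (a , b) = a ≢ b × a ≢ 0# × a ≢ 1# × b ≢ 0# × b ≢ 1#
              × IsSquare (a * b) × IsSquare ((1# - a) * (1# - b))

  InS : Pair → Set
  InS (x , y) = IsSquare x × IsSquare y × x ≢ y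
              × x ≢ 0# × x ≢ 1# × y ≢ 0# × y ≢ 1#

  Ψ : Pair → Pair
  Ψ (a , b) = (a * b ⁻¹ , (1# - a) * (1# - b) ⁻¹)

  ψ : Pair → Carrier → Carrier
  ψ (a , b) u with isSquare? u
  ... | yes _ = a * u
  ... | no _ = b * u

  InE : Pair → Pair → Set
  InE ab (u , v) = ¬ (u ≡ 0# × v ≡ 0#)
    × ψ ab (ψ ab u - v) ≡ ψ ab (- v) + ψ ab (u - v - ψ ab (- v))

  Bit : Fin 2 → Carrier → Set
  Bit k w = (k ≡ Fin.zero → IsSquare w) × (IsSquare w → k ≡ Fin.zero)

  InEij : (i j r s : Fin 2) → Pair → Pair → Set
  InEij i j r s ab (u , v) = InE ab (u , v)
    × Bit i u × Bit j (- v) × Bit r (ψ ab u - v) × Bit s (u - v - ψ ab (- v))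

  InΣij : (i j r s : Fin 2) → Pair → Set
  InΣij i j r s ab = InΣ ab × ∃ λ uv → InEij i j r s ab uv

  InSij : (i j r s : Fin 2) → Pair → Set
  InSij i j r s xy = ∃ λ ab → InΣij i j r s ab × Ψ ab ≡ xy

  T : Pair → Set
  T xy = InS xy × (∀ i j r s → ¬ InSij i j r s xy)

  one minusOne : ℤ
  one = + 1
  minusOne = -[1+ 0 ]

  T₀ T₀′ : Pair → Set
  T₀ (x , y) = T (x , y) × χ (y - x) ≡ one
  T₀′ (x , y) = T (x , y) × χ (x - y) ≡ one

  T₁ε T₁ε′ : ℤ → Pair → Set
  T₁ε ε (x , y) = T₀ (x , y) × χ (1# - y) ≡ ε × χ (1# - x) ≡ ε
  T₁ε′ ε (x , y) = T₀′ (x , y) × χ (1# - x) ≡ ε × χ (1# - y) ≡ ε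

  T₁₁ T₁₋₁ T₂ T₁ T₁₁′ T₁₋₁′ T₂′ T₁′ : Pair → Set
  T₁₁ = T₁ε one
  T₁₋₁ = T₁ε minusOne
  T₂ (x , y) = T₀ (x , y) × χ (1# - x) ≡ minusOne × χ (1# - y) ≡ one
  T₁ xy = T₁₁ xy ⊎ T₁₋₁ xy
  T₁₁′ = T₁ε′ one
  T₁₋₁′ = T₁ε′ minusOne
  T₂′ (x , y) = T₀′ (x , y) × χ (1# - y) ≡ minusOne × χ (1# - x) ≡ one
  T₁′ xy = T₁₁′ xy ⊎ T₁₋₁′ xy

  swap inv : Pair → Pair
  swap (x , y) = (y , x)
  inv (x , y) = (x ⁻¹ , y ⁻¹)

module _ {A : Set} where
  DisjointUnion : (A → Set) → (A → Set) → (A → Set) → Set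
  DisjointUnion X B C = (∀ p → (X p → B p ⊎ C p) × (B p ⊎ C p → X p))
                      × (∀ p → B p → C p → ⊥)

  MapsOnto : (A → A) → (A → Set) → (A → Set) → Set
  MapsOnto f X Y = (∀ p → X p → Y (f p)) × (∀ p → Y p → ∃ λ p′ → X p′ × f p′ ≡ p)

  Permutes : (A → A) → (A → Set) → Set
  Permutes f X = MapsOnto f X X × (∀ p p′ → X p → X p′ → f p ≡ f p′ → p ≡ p′)

  Exchanges : (A → A) → (A → Set) → (A → Set) → Set
  Exchanges f X Y = MapsOnto f X Y × MapsOnto f Y X

-- Since q - 1 ≡ 2 (mod 4), no group of order four acts freely on the nonzero elements of F.
-- Applied to the groups generated by y ↦ -y together with y ↦ i y (if i² = -1) or y ↦ x / y,
-- this shows that -1 is a nonsquare and that, for x ≠ 0, exactly one of x and -x is a square.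
-- Hence χ (x - y) = - χ (y - x), and for nonzero squares x, y also χ (x⁻¹ - y⁻¹) = χ (y - x)
-- and χ (1 - x⁻¹) = - χ (1 - x).
-- The substitutions (a , b , u , v) ↦ (1 - a , 1 - b , - v , - u) and (a , b , u , v) ↦ (b , a , - u , - v)
-- preserve Σ and the equation defining E, and turn Ψ into (x , y) ↦ (y , x) and (x , y) ↦ (x⁻¹ , y⁻¹);
-- so both maps preserve T, and the identities for χ say how they move T₁, T₂, T₁′ and T₂′.
-- What remains is that χ (y - x) = χ (1 - x) = 1 with χ (1 - y) = -1 never occurs in T:
-- such a pair (x , y) is Ψ (a , b) for some (a , b) ∈ Σ with (1 , 1) ∈ E (a , b).

module Submission where

open import Defs
open import Data.Nat using (ℕ)
open import Data.Nat.DivMod using (_%_)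
open import Data.Integer using (ℤ; +_; -[1+_])
open import Data.Product using (_×_)
open import Data.Sum using (_⊎_)
open import Relation.Binary.PropositionalEquality using (_≡_)
open import Level using (Level; 0ℓ)
open import Data.Nat as ℕ using (zero; suc; _≤_; z≤n; s≤s)
import Data.Nat.Properties as ℕ
open import Data.Nat.DivMod using (m∣n⇒o%n%m≡o%m; m*n%n≡0; [m+kn]%n≡m%n)
open import Data.Nat.Divisibility using (divides)
import Data.Integer as ℤ
import Data.Integer.Properties as ℤ
open import Data.Sign as Sign using (Sign)
open import Data.Fin as Fin using (Fin)
import Data.Fin.Properties as Fin
open import Data.List using (List; []; _∷_; length; map; filter; allFin)
import Data.List.Properties as List
open import Data.List.Membership.Propositional using (_∈_; _─_)
open import Data.List.Membership.Propositional.Properties using (∈-map⁺; ∈-filter⁺; ∈-filter⁻; ∈-allFin)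
open import Data.List.Relation.Unary.Any as Any using (here; there)
import Data.List.Relation.Unary.All as All
open import Data.List.Relation.Unary.AllPairs as AllPairs using (_∷_)
open import Data.List.Relation.Unary.Unique.Propositional using (Unique)
import Data.List.Relation.Unary.Unique.Propositional.Properties as Unique
open import Data.Maybe using (Maybe; just; nothing)
open import Data.Product using (∃; _,_; proj₁; proj₂; uncurry)
open import Data.Sum using (inj₁; inj₂; [_,_])
import Data.Sum as Sum
open import Data.Empty using (⊥; ⊥-elim)
open import Data.Unit using (tt)
open import Function using (_∘_)
open import Function.Bundles using (_↔_; Inverse; Injection; mk↔ₛ′)
open import Function.Properties.Inverse using (↔⇒↣; ↔-sym)
open import Relation.Nullary using (¬_; Dec; yes; no)
open import Relation.Nullary.Decidable using (_×-dec_)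
open import Relation.Unary using (Pred; Decidable; _∩_; ∁; U)
open import Relation.Unary.Properties using (_∩?_; ∁?; U?)
open import Relation.Binary.Definitions using (tri<; tri≈; tri>)
open import Relation.Binary.PropositionalEquality using (_≢_; refl; sym; trans; cong; cong₂; subst; module ≡-Reasoning)
open import Algebra.Bundles using (CommutativeRing)
open import Algebra.Solver.Ring.AlmostCommutativeRing
  using (fromCommutativeRing; _-Raw-AlmostCommutative⟶_)

module _ {A : Set} (f : A → A) where

  involution-mapsOnto : ∀ {X Y : A → Set} → (∀ p → X p → Y (f p)) → (∀ p → Y p → X (f p)) →
    (∀ p → Y p → f (f p) ≡ p) → MapsOnto f X Y
  involution-mapsOnto X→Y Y→X f²≡id = X→Y , λ p Yp → f p , Y→X p Yp , f²≡id p Yp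

  involution-exchanges : ∀ {X Y : A → Set} → (∀ p → X p → Y (f p)) → (∀ p → Y p → X (f p)) →
    (∀ p → X p → f (f p) ≡ p) → (∀ p → Y p → f (f p) ≡ p) → Exchanges f X Y
  involution-exchanges X→Y Y→X f²≡id-on-X f²≡id-on-Y =
    involution-mapsOnto X→Y Y→X f²≡id-on-Y , involution-mapsOnto Y→X X→Y f²≡id-on-X

  involution-permutes : ∀ {X : A → Set} → (∀ p → X p → X (f p)) → (∀ p → X p → f (f p) ≡ p) → Permutes f X
  involution-permutes X→X f²≡id = involution-mapsOnto X→X X→X f²≡id ,
    λ p p′ Xp Xp′ fp≡fp′ → trans (sym (f²≡id p Xp)) (trans (cong f fp≡fp′) (f²≡id p′ Xp′))

-- Normal forms are compared by evaluation, so the coefficients must compute: they are integers,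
-- interpreted in R through fromℤ.
module IntegerCoefficientSolver {c ℓ : Level} (R : CommutativeRing c ℓ) where

  open CommutativeRing R
    renaming (refl to ≈-refl; sym to ≈-sym; trans to ≈-trans; reflexive to ≈-reflexive)
  open import Algebra.Properties.Semiring.Mult.TCOptimised semiring using (×-homo-+; ×1-homo-*)
    renaming (_×_ to _·_)
  open import Algebra.Properties.Ring ring using (-‿distribˡ-*; -‿distribʳ-*; -‿involutive)
  open import Algebra.Properties.AbelianGroup +-abelianGroup using (⁻¹-∙-comm; ε⁻¹≈ε)
  open import Algebra.Properties.CommutativeSemigroup +-commutativeSemigroup using (interchange)
  open import Relation.Binary.Reasoning.Setoid setoid

  fromℤ : ℤ → Carrier
  fromℤ (+ n) = n · 1#
  fromℤ -[1+ n ] = - (suc n · 1#)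

  private
    cancel-1+ : ∀ a b → (1# + a) - (1# + b) ≈ a - b
    cancel-1+ a b = begin
      (1# + a) + - (1# + b)    ≈⟨ +-congˡ (⁻¹-∙-comm 1# b) ⟨
      (1# + a) + (- 1# + - b)  ≈⟨ interchange 1# a (- 1#) (- b) ⟩
      (1# + - 1#) + (a + - b)  ≈⟨ +-congʳ (-‿inverseʳ 1#) ⟩
      0# + (a + - b)           ≈⟨ +-identityˡ _ ⟩
      a + - b                  ∎

    fromℤ-⊖ : ∀ m n → fromℤ (m ℤ.⊖ n) ≈ m · 1# - n · 1#
    fromℤ-⊖ m zero = ≈-sym (≈-trans (+-congˡ ε⁻¹≈ε) (+-identityʳ _))
    fromℤ-⊖ zero (suc n) = ≈-sym (+-identityˡ _)
    fromℤ-⊖ (suc m) (suc n) = begin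
      fromℤ (suc m ℤ.⊖ suc n)           ≡⟨ cong fromℤ (ℤ.[1+m]⊖[1+n]≡m⊖n m n) ⟩
      fromℤ (m ℤ.⊖ n)                   ≈⟨ fromℤ-⊖ m n ⟩
      m · 1# - n · 1#                   ≈⟨ cancel-1+ _ _ ⟨
      (1# + m · 1#) - (1# + n · 1#)     ≈⟨ -‿cong-sub (×-homo-+ 1# 1 m) (×-homo-+ 1# 1 n) ⟨
      suc m · 1# - suc n · 1#           ∎
      where
      -‿cong-sub : ∀ {a b c d} → a ≈ b → c ≈ d → a - c ≈ b - d
      -‿cong-sub a≈b c≈d = +-cong a≈b (-‿cong c≈d)

    fromℤ-+ : ∀ i j → fromℤ (i ℤ.+ j) ≈ fromℤ i + fromℤ j
    fromℤ-+ -[1+ m ] -[1+ n ] = begin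
      - (suc (suc (m ℕ.+ n)) · 1#)      ≡⟨ cong (λ k → - (suc k · 1#)) (ℕ.+-suc m n) ⟨
      - ((suc m ℕ.+ suc n) · 1#)        ≈⟨ -‿cong (×-homo-+ 1# (suc m) (suc n)) ⟩
      - (suc m · 1# + suc n · 1#)       ≈⟨ ⁻¹-∙-comm _ _ ⟨
      - (suc m · 1#) + - (suc n · 1#)   ∎
    fromℤ-+ -[1+ m ] (+ n) = ≈-trans (fromℤ-⊖ n (suc m)) (+-comm _ _)
    fromℤ-+ (+ m) -[1+ n ] = fromℤ-⊖ m (suc n)
    fromℤ-+ (+ m) (+ n) = ×-homo-+ 1# m n

    fromℤ-neg : ∀ i → fromℤ (ℤ.- i) ≈ - fromℤ i
    fromℤ-neg (+ zero) = ≈-sym ε⁻¹≈ε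
    fromℤ-neg (+ suc n) = ≈-refl
    fromℤ-neg -[1+ n ] = ≈-sym (-‿involutive _)

    fromℤ-neg-* : ∀ m n → fromℤ (Sign.- ℤ.◃ m ℕ.* n) ≈ - (m · 1# * n · 1#)
    fromℤ-neg-* m n = begin
      fromℤ (Sign.- ℤ.◃ m ℕ.* n)  ≡⟨ cong fromℤ (ℤ.-◃n≡-n (m ℕ.* n)) ⟩
      fromℤ (ℤ.- + (m ℕ.* n))      ≈⟨ fromℤ-neg (+ (m ℕ.* n)) ⟩
      - ((m ℕ.* n) · 1#)           ≈⟨ -‿cong (×1-homo-* m n) ⟩
      - (m · 1# * n · 1#)          ∎

    fromℤ-* : ∀ i j → fromℤ (i ℤ.* j) ≈ fromℤ i * fromℤ j
    fromℤ-* (+ m) (+ n) = ≈-trans (≈-reflexive (cong fromℤ (ℤ.+◃n≡+n (m ℕ.* n)))) (×1-homo-* m n)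
    fromℤ-* (+ m) -[1+ n ] = ≈-trans (fromℤ-neg-* m (suc n)) (-‿distribʳ-* _ _)
    fromℤ-* -[1+ m ] (+ n) = ≈-trans (fromℤ-neg-* (suc m) n) (-‿distribˡ-* _ _)
    fromℤ-* -[1+ m ] -[1+ n ] = begin
      (suc m ℕ.* suc n) · 1#             ≈⟨ ×1-homo-* (suc m) (suc n) ⟩
      suc m · 1# * suc n · 1#            ≈⟨ -‿involutive _ ⟨
      - - (suc m · 1# * suc n · 1#)      ≈⟨ -‿cong (-‿distribˡ-* _ _) ⟩
      - (- (suc m · 1#) * suc n · 1#)    ≈⟨ -‿distribʳ-* _ _ ⟩
      - (suc m · 1#) * - (suc n · 1#)    ∎

    homomorphism : ℤ.+-*-rawRing -Raw-AlmostCommutative⟶ fromCommutativeRing R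
    homomorphism = record
      { ⟦_⟧ = fromℤ ; +-homo = fromℤ-+ ; *-homo = fromℤ-* ; -‿homo = fromℤ-neg
      ; 0-homo = ≈-refl ; 1-homo = ≈-refl }

    fromℤ-≟ : ∀ i j → Maybe (fromℤ i ≈ fromℤ j)
    fromℤ-≟ i j with i ℤ.≟ j
    ... | yes i≡j = just (≈-reflexive (cong fromℤ i≡j))
    ... | no _ = nothing

  open import Algebra.Solver.Ring ℤ.+-*-rawRing (fromCommutativeRing R) homomorphism fromℤ-≟ public
    using (Polynomial; solve; _:=_; _:+_; _:*_; :-_; _:-_; con)

  :0 :1 : ∀ {n} → Polynomial n
  :0 = con (ℤ.+ 0)
  :1 = con (ℤ.+ 1)

module _ {A : Set} where

  ∈-─ : ∀ {w y : A} {ys} (p : y ∈ ys) → w ∈ ys → w ≢ y → w ∈ ys ─ p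
  ∈-─ (here refl) (here refl) w≢y = ⊥-elim (w≢y refl)
  ∈-─ (here refl) (there w∈ys) _ = w∈ys
  ∈-─ (there p) (here refl) _ = here refl
  ∈-─ (there p) (there w∈ys) w≢y = there (∈-─ p w∈ys w≢y)

  length-filter-∁ : {P : Pred A 0ℓ} (P? : Decidable P) → ∀ xs →
    length xs ≡ length (filter P? xs) ℕ.+ length (filter (∁? P?) xs)
  length-filter-∁ P? [] = refl
  length-filter-∁ P? (x ∷ xs) with P? x
  ... | yes _ = cong suc (length-filter-∁ P? xs)
  ... | no _ = trans (cong suc (length-filter-∁ P? xs)) (sym (ℕ.+-suc _ _))

  length-filter-split : {P Q : Pred A 0ℓ} (P? : Decidable P) (Q? : Decidable Q) → ∀ xs →
    length (filter P? xs) ≡ length (filter (P? ∩? Q?) xs) ℕ.+ length (filter (P? ∩? ∁? Q?) xs)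
  length-filter-split P? Q? [] = refl
  length-filter-split P? Q? (x ∷ xs) with P? x | Q? x
  ... | yes _ | yes _ = cong suc (length-filter-split P? Q? xs)
  ... | yes _ | no _ = trans (cong suc (length-filter-split P? Q? xs)) (sym (ℕ.+-suc _ _))
  ... | no _ | yes _ = length-filter-split P? Q? xs
  ... | no _ | no _ = length-filter-split P? Q? xs

module _ {A B : Set} where

  length-≤-injection : (f : A → B) {xs : List A} {ys : List B} → Unique xs →
    (∀ {x} → x ∈ xs → f x ∈ ys) → (∀ {x y} → x ∈ xs → y ∈ xs → f x ≡ f y → x ≡ y) →
    length xs ≤ length ys
  length-≤-injection f {[]} _ _ _ = z≤n
  length-≤-injection f {x ∷ xs} {ys} (x∉xs ∷ xs-unique) into inj =
    subst (suc (length xs) ≤_) (sym (List.length-removeAt′ ys (Any.index fx∈ys)))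
      (s≤s (length-≤-injection f xs-unique into′ (λ p q → inj (there p) (there q))))
    where
    fx∈ys : f x ∈ ys
    fx∈ys = into (here refl)
    into′ : ∀ {w} → w ∈ xs → f w ∈ ys ─ fx∈ys
    into′ w∈xs = ∈-─ fx∈ys (into (there w∈xs))
      (λ fw≡fx → All.lookup x∉xs w∈xs (sym (inj (there w∈xs) (here refl) fw≡fx)))

module FiniteCounting {A : Set} {n : ℕ} (A↔Fin : A ↔ Fin n) where
  open Inverse A↔Fin using (to; from; strictlyInverseʳ)

  to-injective : ∀ {x y} → to x ≡ to y → x ≡ y
  to-injective = Injection.injective (↔⇒↣ A↔Fin)

  elements : List A
  elements = map from (allFin n)

  ∈-elements : ∀ x → x ∈ elements
  ∈-elements x = subst (_∈ elements) (strictlyInverseʳ x) (∈-map⁺ from (∈-allFin (to x)))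

  elements-unique : Unique elements
  elements-unique = Unique.map⁺ (Injection.injective (↔⇒↣ (↔-sym A↔Fin))) (Unique.allFin⁺ n)

  length-elements : length elements ≡ n
  length-elements = trans (List.length-map from (allFin n)) (List.length-tabulate (λ i → i))

  count : {P : Pred A 0ℓ} → Decidable P → ℕ
  count P? = length (filter P? elements)

  count-≤ : ∀ {P Q : Pred A 0ℓ} (P? : Decidable P) (Q? : Decidable Q) (f : A → A) →
    (∀ {x} → P x → Q (f x)) → (∀ {x y} → P x → P y → f x ≡ f y → x ≡ y) → count P? ≤ count Q?
  count-≤ {P} P? Q? f P⇒Qf inj = length-≤-injection f (Unique.filter⁺ P? elements-unique)
    (λ {x} x∈ → ∈-filter⁺ Q? (∈-elements (f x)) (P⇒Qf (selected x∈)))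
    (λ x∈ y∈ → inj (selected x∈) (selected y∈))
    where
    selected : ∀ {x} → x ∈ filter P? elements → P x
    selected x∈ = proj₂ (∈-filter⁻ P? {xs = elements} x∈)

  count-U : count U? ≡ n
  count-U = trans (cong length (List.filter-all U? (All.universal (λ _ → tt) elements))) length-elements

  count-∁ : {P : Pred A 0ℓ} (P? : Decidable P) → n ≡ count P? ℕ.+ count (∁? P?)
  count-∁ P? = trans (sym length-elements) (length-filter-∁ P? elements)

  count-singleton : ∀ {a} (≡a? : Decidable (_≡ a)) → count ≡a? ≡ 1
  count-singleton {a} ≡a? = ℕ.≤-antisym
    (length-≤-injection (λ x → x) {ys = a ∷ []} (Unique.filter⁺ ≡a? elements-unique)
      (λ x∈ → here (proj₂ (∈-filter⁻ ≡a? {xs = elements} x∈))) (λ _ _ eq → eq))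
    (length-≤-injection (λ x → x) {a ∷ []} (All.[] ∷ AllPairs.[])
      (λ { (here refl) → ∈-filter⁺ ≡a? (∈-elements a) refl }) (λ _ _ eq → eq))

  count-split : {P Q : Pred A 0ℓ} (P? : Decidable P) (Q? : Decidable Q) →
    count P? ≡ count (P? ∩? Q?) ℕ.+ count (P? ∩? ∁? Q?)
  count-split P? Q? = length-filter-split P? Q? elements

  module Involution {X : Pred A 0ℓ} (X? : Decidable X) (σ : A → A)
    (σ-closed : ∀ {x} → X x → X (σ x)) (σ-involutive : ∀ {x} → X x → σ (σ x) ≡ x)
    (σ-fixpointFree : ∀ {x} → X x → σ x ≢ x) where

    Lower : Pred A 0ℓ
    Lower x = to x Fin.< to (σ x)

    half? : Decidable (X ∩ Lower)
    half? x = X? x ×-dec (to x Fin.<? to (σ x))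

    lower-or-partner-lower : ∀ {x} → X x → Lower x ⊎ Lower (σ x)
    lower-or-partner-lower {x} Xx with Fin.<-cmp (to x) (to (σ x))
    ... | tri< x<σx _ _ = inj₁ x<σx
    ... | tri≈ _ x≡σx _ = ⊥-elim (σ-fixpointFree Xx (sym (to-injective x≡σx)))
    ... | tri> _ _ σx<x = inj₂ (subst (λ z → to (σ x) Fin.< to z) (sym (σ-involutive Xx)) σx<x)

    lower⇒partner-not-lower : ∀ {x} → X x → Lower x → ¬ Lower (σ x)
    lower⇒partner-not-lower Xx x<σx σx<σσx =
      Fin.<-asym x<σx (subst (λ z → to (σ _) Fin.< to z) (σ-involutive Xx) σx<σσx)

    σ-injective : ∀ {x y} → X x → X y → σ x ≡ σ y → x ≡ y
    σ-injective Xx Xy σx≡σy = trans (sym (σ-involutive Xx)) (trans (cong σ σx≡σy) (σ-involutive Xy))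

    count-halves : count X? ≡ 2 ℕ.* count half?
    count-halves = begin
      count X?                                  ≡⟨ count-split X? lower? ⟩
      count half? ℕ.+ count (X? ∩? ∁? lower?)   ≡⟨ cong (count half? ℕ.+_) upper≡lower ⟩
      count half? ℕ.+ count half?               ≡⟨ cong (count half? ℕ.+_) (ℕ.+-identityʳ _) ⟨
      2 ℕ.* count half?                         ∎
      where
      open ≡-Reasoning
      lower? : Decidable Lower
      lower? x = to x Fin.<? to (σ x)
      σ-lowers : ∀ {x} → (X ∩ ∁ Lower) x → (X ∩ Lower) (σ x)
      σ-lowers (Xx , ¬lower) with lower-or-partner-lower Xx
      ... | inj₁ lower = ⊥-elim (¬lower lower)
      ... | inj₂ σx-lower = σ-closed Xx , σx-lower
      σ-uppers : ∀ {x} → (X ∩ Lower) x → (X ∩ ∁ Lower) (σ x)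
      σ-uppers (Xx , lower) = σ-closed Xx , lower⇒partner-not-lower Xx lower
      upper≡lower : count (X? ∩? ∁? lower?) ≡ count half?
      upper≡lower = ℕ.≤-antisym
        (count-≤ (X? ∩? ∁? lower?) half? σ σ-lowers (λ p q → σ-injective (proj₁ p) (proj₁ q)))
        (count-≤ half? (X? ∩? ∁? lower?) σ σ-uppers (λ p q → σ-injective (proj₁ p) (proj₁ q)))

  module FreeKleinAction {X : Pred A 0ℓ} (X? : Decidable X) (σ τ : A → A)
    (σ-closed : ∀ {x} → X x → X (σ x)) (σ-involutive : ∀ {x} → X x → σ (σ x) ≡ x)
    (σ-fixpointFree : ∀ {x} → X x → σ x ≢ x)
    (τ-closed : ∀ {x} → X x → X (τ x)) (σ-τ-commute : ∀ {x} → X x → σ (τ x) ≡ τ (σ x))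
    (τ²∈⟨σ⟩ : ∀ {x} → X x → τ (τ x) ≡ x ⊎ τ (τ x) ≡ σ x)
    (τ-fixpointFree : ∀ {x} → X x → τ x ≢ x) (στ-fixpointFree : ∀ {x} → X x → σ (τ x) ≢ x) where

    open Involution X? σ σ-closed σ-involutive σ-fixpointFree

    representative : A → A
    representative y with half? y
    ... | yes _ = y
    ... | no _ = σ y

    representative-cases : ∀ y → representative y ≡ y ⊎ representative y ≡ σ y
    representative-cases y with half? y
    ... | yes _ = inj₁ refl
    ... | no _ = inj₂ refl

    representative-∈-half : ∀ {y} → X y → (X ∩ Lower) (representative y)
    representative-∈-half {y} Xy with half? y | lower-or-partner-lower Xy
    ... | yes y-half | _ = y-half
    ... | no ¬y-half | inj₁ y-lower = ⊥-elim (¬y-half (Xy , y-lower))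
    ... | no _ | inj₂ σy-lower = σ-closed Xy , σy-lower

    representative-of-half : ∀ {x} → (X ∩ Lower) x → representative x ≡ x
    representative-of-half {x} x-half with half? x
    ... | yes _ = refl
    ... | no ¬x-half = ⊥-elim (¬x-half x-half)

    representative-of-partner : ∀ {x} → (X ∩ Lower) x → representative (σ x) ≡ x
    representative-of-partner {x} (Xx , x-lower) with half? (σ x)
    ... | yes (_ , σx-lower) = ⊥-elim (lower⇒partner-not-lower Xx x-lower σx-lower)
    ... | no _ = σ-involutive Xx

    -- τ acting on the σ-orbits, each orbit represented by its Lower element.
    ρ : A → A
    ρ x = representative (τ x)

    τ∘ρ∈⟨σ⟩ : ∀ {x} → X x → τ (ρ x) ≡ x ⊎ τ (ρ x) ≡ σ x
    τ∘ρ∈⟨σ⟩ {x} Xx with representative-cases (τ x) | τ²∈⟨σ⟩ Xx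
    ... | inj₁ ρx≡τx | ττx≡x⊎σx = subst (λ z → τ z ≡ x ⊎ τ z ≡ σ x) (sym ρx≡τx) ττx≡x⊎σx
    ... | inj₂ ρx≡στx | inj₁ ττx≡x = inj₂ (begin
      τ (ρ x)       ≡⟨ cong τ ρx≡στx ⟩
      τ (σ (τ x))   ≡⟨ σ-τ-commute (τ-closed Xx) ⟨
      σ (τ (τ x))   ≡⟨ cong σ ττx≡x ⟩
      σ x           ∎)
      where open ≡-Reasoning
    ... | inj₂ ρx≡στx | inj₂ ττx≡σx = inj₁ (begin
      τ (ρ x)       ≡⟨ cong τ ρx≡στx ⟩
      τ (σ (τ x))   ≡⟨ σ-τ-commute (τ-closed Xx) ⟨
      σ (τ (τ x))   ≡⟨ cong σ ττx≡σx ⟩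
      σ (σ x)       ≡⟨ σ-involutive Xx ⟩
      x             ∎)
      where open ≡-Reasoning

    ρ-closed : ∀ {x} → (X ∩ Lower) x → (X ∩ Lower) (ρ x)
    ρ-closed (Xx , _) = representative-∈-half (τ-closed Xx)

    ρ-involutive : ∀ {x} → (X ∩ Lower) x → ρ (ρ x) ≡ x
    ρ-involutive x-half@(Xx , _) with τ∘ρ∈⟨σ⟩ Xx
    ... | inj₁ τρx≡x = trans (cong representative τρx≡x) (representative-of-half x-half)
    ... | inj₂ τρx≡σx = trans (cong representative τρx≡σx) (representative-of-partner x-half)

    ρ-fixpointFree : ∀ {x} → (X ∩ Lower) x → ρ x ≢ x
    ρ-fixpointFree {x} (Xx , _) ρx≡x with representative-cases (τ x)
    ... | inj₁ ρx≡τx = τ-fixpointFree Xx (trans (sym ρx≡τx) ρx≡x)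
    ... | inj₂ ρx≡στx = στ-fixpointFree Xx (trans (sym ρx≡στx) ρx≡x)

    count-multiple-of-4 : ∃ λ k → count X? ≡ 4 ℕ.* k
    count-multiple-of-4 = count ρ-halves.half? , (begin
      count X?                              ≡⟨ count-halves ⟩
      2 ℕ.* count half?                     ≡⟨ cong (2 ℕ.*_) ρ-halves.count-halves ⟩
      2 ℕ.* (2 ℕ.* count ρ-halves.half?)    ≡⟨ ℕ.*-assoc 2 2 (count ρ-halves.half?) ⟨
      4 ℕ.* count ρ-halves.half?            ∎)
      where
      open ≡-Reasoning
      module ρ-halves = Involution half? ρ ρ-closed ρ-involutive ρ-fixpointFree

≡3-mod-4⇒odd : ∀ {q} → q % 4 ≡ 3 → ∀ k → q ≢ 2 ℕ.* k
≡3-mod-4⇒odd {q} q%4≡3 k q≡2k = 1≢0 (begin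
  1              ≡⟨ cong (_% 2) q%4≡3 ⟨
  q % 4 % 2      ≡⟨ m∣n⇒o%n%m≡o%m 2 4 q (divides 2 refl) ⟩
  q % 2          ≡⟨ cong (_% 2) (trans q≡2k (ℕ.*-comm 2 k)) ⟩
  k ℕ.* 2 % 2      ≡⟨ m*n%n≡0 k 2 ⟩
  0              ∎)
  where
  open ≡-Reasoning
  1≢0 : 1 ≢ 0
  1≢0 ()

≡3-mod-4⇒≢1-mod-4 : ∀ {q} → q % 4 ≡ 3 → ∀ k → q ≢ 1 ℕ.+ 4 ℕ.* k
≡3-mod-4⇒≢1-mod-4 {q} q%4≡3 k q≡1+4k = 3≢1 (begin
  3                 ≡⟨ q%4≡3 ⟨
  q % 4             ≡⟨ cong (_% 4) (trans q≡1+4k (cong (1 ℕ.+_) (ℕ.*-comm 4 k))) ⟩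
  (1 ℕ.+ k ℕ.* 4) % 4   ≡⟨ [m+kn]%n≡m%n 1 k 4 ⟩
  1                 ∎)
  where
  open ≡-Reasoning
  3≢1 : 3 ≢ 1
  3≢1 ()

module FieldProperties {q : ℕ} (F : FiniteField q) where
  open FiniteField F

  commutativeRing : CommutativeRing 0ℓ 0ℓ
  commutativeRing = record { isCommutativeRing = isCommutativeRing }

  open CommutativeRing commutativeRing
    using (+-identityˡ; *-assoc; *-comm; *-identityˡ; *-identityʳ; zeroˡ; zeroʳ; ring; +-abelianGroup)
  open import Algebra.Properties.Ring ring public
    using (-‿involutive; -‿distribˡ-*; -‿distribʳ-*; -1*x≈-x)
  open import Algebra.Properties.AbelianGroup +-abelianGroup public
    using (ε⁻¹≈ε; ⁻¹-∙-comm; ⁻¹-anti-homo‿-)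
  open IntegerCoefficientSolver commutativeRing
  open ≡-Reasoning

  1≢0 : 1# ≢ 0#
  1≢0 1≡0 = 0≢1 (sym 1≡0)

  x-y≡0⇒x≡y : ∀ {x y} → x - y ≡ 0# → x ≡ y
  x-y≡0⇒x≡y {x} {y} x-y≡0 = begin
    x              ≡⟨ solve 2 (λ x y → x := (x :- y) :+ y) refl x y ⟩
    (x - y) + y    ≡⟨ cong (_+ y) x-y≡0 ⟩
    0# + y         ≡⟨ +-identityˡ y ⟩
    y              ∎

  x*y*y⁻¹≡x : ∀ x {y} → y ≢ 0# → x * y * y ⁻¹ ≡ x
  x*y*y⁻¹≡x x {y} y≢0 = begin
    x * y * y ⁻¹     ≡⟨ *-assoc x y (y ⁻¹) ⟩
    x * (y * y ⁻¹)   ≡⟨ cong (x *_) (⁻¹-inverse y y≢0) ⟩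
    x * 1#           ≡⟨ *-identityʳ x ⟩
    x                ∎

  x*y⁻¹*y≡x : ∀ x {y} → y ≢ 0# → x * y ⁻¹ * y ≡ x
  x*y⁻¹*y≡x x {y} y≢0 = begin
    x * y ⁻¹ * y     ≡⟨ *-assoc x (y ⁻¹) y ⟩
    x * (y ⁻¹ * y)   ≡⟨ cong (x *_) (trans (*-comm (y ⁻¹) y) (⁻¹-inverse y y≢0)) ⟩
    x * 1#           ≡⟨ *-identityʳ x ⟩
    x                ∎

  *-cancelʳ-≢0 : ∀ {x y z} → z ≢ 0# → x * z ≡ y * z → x ≡ y
  *-cancelʳ-≢0 {x} {y} {z} z≢0 xz≡yz = begin
    x              ≡⟨ x*y*y⁻¹≡x x z≢0 ⟨
    x * z * z ⁻¹   ≡⟨ cong (_* z ⁻¹) xz≡yz ⟩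
    y * z * z ⁻¹   ≡⟨ x*y*y⁻¹≡x y z≢0 ⟩
    y              ∎

  *-≢0 : ∀ {x y} → x ≢ 0# → y ≢ 0# → x * y ≢ 0#
  *-≢0 {x} {y} x≢0 y≢0 xy≡0 = x≢0 (*-cancelʳ-≢0 y≢0 (trans xy≡0 (sym (zeroˡ y))))

  -x≡0⇒x≡0 : ∀ {x} → - x ≡ 0# → x ≡ 0#
  -x≡0⇒x≡0 {x} -x≡0 = begin
    x       ≡⟨ -‿involutive x ⟨
    - - x   ≡⟨ cong -_ -x≡0 ⟩
    - 0#    ≡⟨ ε⁻¹≈ε ⟩
    0#      ∎

  -‿≢0 : ∀ {x} → x ≢ 0# → - x ≢ 0#
  -‿≢0 x≢0 -x≡0 = x≢0 (-x≡0⇒x≡0 -x≡0)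

  1-[1-x]≡x : ∀ x → 1# - (1# - x) ≡ x
  1-[1-x]≡x = solve 1 (λ x → :1 :- (:1 :- x) := x) refl

  1-‿injective : ∀ {x y} → 1# - x ≡ 1# - y → x ≡ y
  1-‿injective {x} {y} 1-x≡1-y = trans (sym (1-[1-x]≡x x)) (trans (cong (λ z → 1# - z) 1-x≡1-y) (1-[1-x]≡x y))

  1-x≢0 : ∀ {x} → x ≢ 1# → 1# - x ≢ 0#
  1-x≢0 x≢1 1-x≡0 = x≢1 (sym (x-y≡0⇒x≡y 1-x≡0))

  1-x≢1 : ∀ {x} → x ≢ 0# → 1# - x ≢ 1#
  1-x≢1 x≢0 1-x≡1 = x≢0 (1-‿injective (trans 1-x≡1 (solve 0 (:1 := :1 :- :0) refl)))

  ⁻¹-inverseˡ : ∀ {x} → x ≢ 0# → x ⁻¹ * x ≡ 1#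
  ⁻¹-inverseˡ {x} x≢0 = trans (*-comm (x ⁻¹) x) (⁻¹-inverse x x≢0)

  ⁻¹-unique : ∀ {x y} → x * y ≡ 1# → y ≡ x ⁻¹
  ⁻¹-unique {x} {y} xy≡1 = begin
    y                ≡⟨ *-identityˡ y ⟨
    1# * y           ≡⟨ cong (_* y) (⁻¹-inverseˡ x≢0) ⟨
    x ⁻¹ * x * y     ≡⟨ *-assoc (x ⁻¹) x y ⟩
    x ⁻¹ * (x * y)   ≡⟨ cong (x ⁻¹ *_) xy≡1 ⟩
    x ⁻¹ * 1#        ≡⟨ *-identityʳ (x ⁻¹) ⟩
    x ⁻¹             ∎
    where
    x≢0 : x ≢ 0#
    x≢0 x≡0 = 1≢0 (trans (sym xy≡1) (trans (cong (_* y) x≡0) (zeroˡ y)))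

  ⁻¹-≢0 : ∀ {x} → x ≢ 0# → x ⁻¹ ≢ 0#
  ⁻¹-≢0 {x} x≢0 x⁻¹≡0 = 1≢0 (trans (sym (⁻¹-inverse x x≢0)) (trans (cong (x *_) x⁻¹≡0) (zeroʳ x)))

  ⁻¹-involutive : ∀ {x} → x ≢ 0# → x ⁻¹ ⁻¹ ≡ x
  ⁻¹-involutive x≢0 = sym (⁻¹-unique (⁻¹-inverseˡ x≢0))

  ⁻¹-injective : ∀ {x y} → x ≢ 0# → y ≢ 0# → x ⁻¹ ≡ y ⁻¹ → x ≡ y
  ⁻¹-injective x≢0 y≢0 x⁻¹≡y⁻¹ =
    trans (sym (⁻¹-involutive x≢0)) (trans (cong _⁻¹ x⁻¹≡y⁻¹) (⁻¹-involutive y≢0))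

  1⁻¹≡1 : 1# ⁻¹ ≡ 1#
  1⁻¹≡1 = sym (⁻¹-unique (*-identityʳ 1#))

  ⁻¹-distrib-* : ∀ {x y} → x ≢ 0# → y ≢ 0# → (x * y) ⁻¹ ≡ x ⁻¹ * y ⁻¹
  ⁻¹-distrib-* {x} {y} x≢0 y≢0 = sym (⁻¹-unique (begin
    x * y * (x ⁻¹ * y ⁻¹)
      ≡⟨ solve 4 (λ x y x′ y′ → x :* y :* (x′ :* y′) := (x :* x′) :* (y :* y′)) refl x y (x ⁻¹) (y ⁻¹) ⟩
    (x * x ⁻¹) * (y * y ⁻¹)     ≡⟨ cong₂ _*_ (⁻¹-inverse x x≢0) (⁻¹-inverse y y≢0) ⟩
    1# * 1#                     ≡⟨ *-identityʳ 1# ⟩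
    1#                          ∎))

  -‿⁻¹ : ∀ {x} → x ≢ 0# → (- x) ⁻¹ ≡ - (x ⁻¹)
  -‿⁻¹ {x} x≢0 = sym (⁻¹-unique
    (trans (solve 2 (λ x y → (:- x) :* (:- y) := x :* y) refl x (x ⁻¹)) (⁻¹-inverse x x≢0)))

  [x*y⁻¹]⁻¹≡y*x⁻¹ : ∀ {x y} → x ≢ 0# → y ≢ 0# → (x * y ⁻¹) ⁻¹ ≡ y * x ⁻¹
  [x*y⁻¹]⁻¹≡y*x⁻¹ {x} {y} x≢0 y≢0 = begin
    (x * y ⁻¹) ⁻¹     ≡⟨ ⁻¹-distrib-* x≢0 (⁻¹-≢0 y≢0) ⟩
    x ⁻¹ * y ⁻¹ ⁻¹    ≡⟨ cong (x ⁻¹ *_) (⁻¹-involutive y≢0) ⟩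
    x ⁻¹ * y          ≡⟨ *-comm (x ⁻¹) y ⟩
    y * x ⁻¹          ∎

  square-1 : IsSquare 1#
  square-1 = 1# , *-identityʳ 1#

  square-* : ∀ {x y} → IsSquare x → IsSquare y → IsSquare (x * y)
  square-* {x} {y} (z , z²≡x) (w , w²≡y) = z * w , (begin
    z * w * (z * w)   ≡⟨ solve 2 (λ z w → z :* w :* (z :* w) := z :* z :* (w :* w)) refl z w ⟩
    z * z * (w * w)   ≡⟨ cong₂ _*_ z²≡x w²≡y ⟩
    x * y             ∎)

  square-⁻¹ : ∀ {x} → x ≢ 0# → IsSquare x → IsSquare (x ⁻¹)
  square-⁻¹ {x} x≢0 (z , z²≡x) = z ⁻¹ , trans (sym (⁻¹-distrib-* z≢0 z≢0)) (cong _⁻¹ z²≡x)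
    where
    z≢0 : z ≢ 0#
    z≢0 z≡0 = x≢0 (trans (sym z²≡x) (trans (cong (_* z) z≡0) (zeroˡ z)))

  square-cancelʳ : ∀ {x y} → y ≢ 0# → IsSquare y → IsSquare (x * y) → IsSquare x
  square-cancelʳ {x} y≢0 □y □xy = subst IsSquare (x*y*y⁻¹≡x x y≢0) (square-* □xy (square-⁻¹ y≢0 □y))

  χ-square : ∀ {x} → x ≢ 0# → IsSquare x → χ x ≡ one
  χ-square {x} x≢0 □x with x ≟ 0#
  ... | yes x≡0 = ⊥-elim (x≢0 x≡0)
  ... | no _ with isSquare? x
  ...   | yes _ = refl
  ...   | no ¬□x = ⊥-elim (¬□x □x)

  χ-nonsquare : ∀ {x} → x ≢ 0# → ¬ IsSquare x → χ x ≡ minusOne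
  χ-nonsquare {x} x≢0 ¬□x with x ≟ 0#
  ... | yes x≡0 = ⊥-elim (x≢0 x≡0)
  ... | no _ with isSquare? x
  ...   | yes □x = ⊥-elim (¬□x □x)
  ...   | no _ = refl

  χ≡1⇒square : ∀ {x} → χ x ≡ one → x ≢ 0# × IsSquare x
  χ≡1⇒square {x} χx≡1 with x ≟ 0#
  χ≡1⇒square () | yes _
  ... | no x≢0 with isSquare? x
  ...   | yes □x = x≢0 , □x
  χ≡1⇒square () | no _ | no _

  χ≡-1⇒nonsquare : ∀ {x} → χ x ≡ minusOne → x ≢ 0# × ¬ IsSquare x
  χ≡-1⇒nonsquare {x} χx≡-1 with x ≟ 0#
  χ≡-1⇒nonsquare () | yes _
  ... | no x≢0 with isSquare? x
  χ≡-1⇒nonsquare () | no _ | yes _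
  ...   | no ¬□x = x≢0 , ¬□x

  χ-≢0 : ∀ {x} → x ≢ 0# → χ x ≡ one ⊎ χ x ≡ minusOne
  χ-≢0 {x} x≢0 with isSquare? x
  ... | yes □x = inj₁ (χ-square x≢0 □x)
  ... | no ¬□x = inj₂ (χ-nonsquare x≢0 ¬□x)

  χ-*-square : ∀ {x y} → y ≢ 0# → IsSquare y → χ (x * y) ≡ χ x
  χ-*-square {x} {y} y≢0 □y = by-cases (x ≟ 0#)
    where
    by-cases : Dec (x ≡ 0#) → χ (x * y) ≡ χ x
    by-cases (yes x≡0) = cong χ (trans (cong (_* y) x≡0) (trans (zeroˡ y) (sym x≡0)))
    by-cases (no x≢0) with isSquare? x
    ... | yes □x = trans (χ-square (*-≢0 x≢0 y≢0) (square-* □x □y)) (sym (χ-square x≢0 □x))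
    ... | no ¬□x = trans (χ-nonsquare (*-≢0 x≢0 y≢0) (λ □xy → ¬□x (square-cancelʳ y≢0 □y □xy)))
                         (sym (χ-nonsquare x≢0 ¬□x))

module QuadraticResidues {q : ℕ} (q%4≡3 : q % 4 ≡ 3) (F : FiniteField q) where
  open FiniteField F
  open FieldProperties F
  open CommutativeRing commutativeRing
    using (+-assoc; +-identityʳ; -‿inverseʳ; *-assoc; *-identityˡ; *-identityʳ; zeroˡ)
  open IntegerCoefficientSolver commutativeRing
  open FiniteCounting (mk↔ₛ′ index enum index-enum enum-index)
  open ≡-Reasoning

  1+1≢0 : 1# + 1# ≢ 0#
  1+1≢0 1+1≡0 = ≡3-mod-4⇒odd q%4≡3 (count half?) (trans (sym count-U) count-halves)
    where
    x+1+1≡x : ∀ {x} → U x → x + 1# + 1# ≡ x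
    x+1+1≡x {x} _ = trans (+-assoc x 1# 1#) (trans (cong (λ z → x + z) 1+1≡0) (+-identityʳ x))
    x+1≢x : ∀ {x} → U x → x + 1# ≢ x
    x+1≢x {x} _ x+1≡x = 1≢0 (begin
      1#               ≡⟨ solve 1 (λ x → :1 := x :+ :1 :- x) refl x ⟩
      x + 1# - x       ≡⟨ cong (_- x) x+1≡x ⟩
      x - x            ≡⟨ -‿inverseʳ x ⟩
      0#               ∎)
    open Involution U? (_+ 1#) (λ _ → tt) x+1+1≡x x+1≢x

  -x≢x : ∀ {x} → x ≢ 0# → - x ≢ x
  -x≢x {x} x≢0 -x≡x = x≢0 (*-cancelʳ-≢0 1+1≢0 (begin
    x * (1# + 1#)    ≡⟨ solve 1 (λ x → x :* (:1 :+ :1) := x :+ x) refl x ⟩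
    x + x            ≡⟨ cong (λ z → x + z) -x≡x ⟨
    x - x            ≡⟨ -‿inverseʳ x ⟩
    0#               ≡⟨ zeroˡ (1# + 1#) ⟨
    0# * (1# + 1#)   ∎))

  no-free-Klein-action : (τ : Carrier → Carrier) →
    (∀ {x} → x ≢ 0# → τ x ≢ 0#) → (∀ {x} → x ≢ 0# → - τ x ≡ τ (- x)) →
    (∀ {x} → x ≢ 0# → τ (τ x) ≡ x ⊎ τ (τ x) ≡ - x) →
    (∀ {x} → x ≢ 0# → τ x ≢ x) → (∀ {x} → x ≢ 0# → - τ x ≢ x) → ⊥
  no-free-Klein-action τ τ-≢0 -τ≡τ- τ²∈⟨-⟩ τ-fixpointFree -τ-fixpointFree =
    q≢1+4k count-multiple-of-4
    where
    open FreeKleinAction (∁? (_≟ 0#)) -_ τ -‿≢0 (λ _ → -‿involutive _) -x≢x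
      τ-≢0 -τ≡τ- τ²∈⟨-⟩ τ-fixpointFree -τ-fixpointFree
    q≢1+4k : (∃ λ k → count (∁? (_≟ 0#)) ≡ 4 ℕ.* k) → ⊥
    q≢1+4k (k , q-1≡4k) = ≡3-mod-4⇒≢1-mod-4 q%4≡3 k (begin
      q                                       ≡⟨ count-∁ (_≟ 0#) ⟩
      count (_≟ 0#) ℕ.+ count (∁? (_≟ 0#))    ≡⟨ cong₂ ℕ._+_ (count-singleton (_≟ 0#)) q-1≡4k ⟩
      1 ℕ.+ 4 ℕ.* k                           ∎)

  -1-nonsquare : ¬ IsSquare (- 1#)
  -1-nonsquare (i , i²≡-1) = no-free-Klein-action (i *_) (*-≢0 i≢0) -ix≡i-x i²x≡-x ix≢x -ix≢x
    where
    -1≢1 : - 1# ≢ 1#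
    -1≢1 = -x≢x 1≢0
    i≢0 : i ≢ 0#
    i≢0 i≡0 = -‿≢0 1≢0 (trans (sym i²≡-1) (trans (cong (_* i) i≡0) (zeroˡ i)))
    i≢±1 : ∀ {s} → s * s ≡ 1# → i ≢ s
    i≢±1 {s} s²≡1 i≡s = -1≢1 (trans (sym i²≡-1) (trans (cong₂ _*_ i≡s i≡s) s²≡1))
    -ix≡i-x : ∀ {x} → x ≢ 0# → - (i * x) ≡ i * - x
    -ix≡i-x {x} _ = -‿distribʳ-* i x
    i²x≡-x : ∀ {x} → x ≢ 0# → i * (i * x) ≡ x ⊎ i * (i * x) ≡ - x
    i²x≡-x {x} _ = inj₂ (begin
      i * (i * x)   ≡⟨ *-assoc i i x ⟨
      i * i * x     ≡⟨ cong (_* x) i²≡-1 ⟩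
      - 1# * x      ≡⟨ -1*x≈-x x ⟩
      - x           ∎)
    ix≢x : ∀ {x} → x ≢ 0# → i * x ≢ x
    ix≢x x≢0 ix≡x = i≢±1 (*-identityʳ 1#) (*-cancelʳ-≢0 x≢0 (trans ix≡x (sym (*-identityˡ _))))
    -ix≢x : ∀ {x} → x ≢ 0# → - (i * x) ≢ x
    -ix≢x {x} x≢0 -ix≡x = i≢±1 (solve 0 (:- :1 :* :- :1 := :1) refl)
      (*-cancelʳ-≢0 x≢0 (begin
        i * x          ≡⟨ solve 2 (λ i x → i :* x := :- :1 :* :- (i :* x)) refl i x ⟩
        - 1# * - (i * x) ≡⟨ cong (- 1# *_) -ix≡x ⟩
        - 1# * x       ∎))

  nonsquare⇒-square : ∀ {x} → x ≢ 0# → ¬ IsSquare x → IsSquare (- x)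
  nonsquare⇒-square {x} x≢0 ¬□x with isSquare? (- x)
  ... | yes □-x = □-x
  ... | no ¬□-x = ⊥-elim (no-free-Klein-action (λ y → x * y ⁻¹)
        (λ y≢0 → *-≢0 x≢0 (⁻¹-≢0 y≢0)) -τ≡τ- τ²≡id τ-fixpointFree -τ-fixpointFree)
    where
    -τ≡τ- : ∀ {y} → y ≢ 0# → - (x * y ⁻¹) ≡ x * (- y) ⁻¹
    -τ≡τ- {y} y≢0 = begin
      - (x * y ⁻¹)     ≡⟨ -‿distribʳ-* x (y ⁻¹) ⟩
      x * - (y ⁻¹)     ≡⟨ cong (x *_) (-‿⁻¹ y≢0) ⟨
      x * (- y) ⁻¹     ∎
    τ²≡id : ∀ {y} → y ≢ 0# → x * (x * y ⁻¹) ⁻¹ ≡ y ⊎ x * (x * y ⁻¹) ⁻¹ ≡ - y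
    τ²≡id {y} y≢0 = inj₁ (begin
      x * (x * y ⁻¹) ⁻¹       ≡⟨ cong (x *_) (⁻¹-distrib-* x≢0 (⁻¹-≢0 y≢0)) ⟩
      x * (x ⁻¹ * y ⁻¹ ⁻¹)    ≡⟨ cong (λ z → x * (x ⁻¹ * z)) (⁻¹-involutive y≢0) ⟩
      x * (x ⁻¹ * y)          ≡⟨ *-assoc x (x ⁻¹) y ⟨
      x * x ⁻¹ * y            ≡⟨ cong (_* y) (⁻¹-inverse x x≢0) ⟩
      1# * y                  ≡⟨ *-identityˡ y ⟩
      y                       ∎)
    τ-fixpointFree : ∀ {y} → y ≢ 0# → x * y ⁻¹ ≢ y
    τ-fixpointFree {y} y≢0 x/y≡y = ¬□x (y , (begin
      y * y             ≡⟨ cong (_* y) x/y≡y ⟨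
      x * y ⁻¹ * y      ≡⟨ x*y⁻¹*y≡x x y≢0 ⟩
      x                 ∎))
    -τ-fixpointFree : ∀ {y} → y ≢ 0# → - (x * y ⁻¹) ≢ y
    -τ-fixpointFree {y} y≢0 -x/y≡y = ¬□-x (y , (begin
      y * y               ≡⟨ cong (_* y) -x/y≡y ⟨
      - (x * y ⁻¹) * y    ≡⟨ -‿distribˡ-* (x * y ⁻¹) y ⟨
      - (x * y ⁻¹ * y)    ≡⟨ cong -_ (x*y⁻¹*y≡x x y≢0) ⟩
      - x                 ∎))

  square⇒-nonsquare : ∀ {x} → x ≢ 0# → IsSquare x → ¬ IsSquare (- x)
  square⇒-nonsquare {x} x≢0 □x □-x = -1-nonsquare (square-cancelʳ x≢0 □x
    (subst IsSquare (sym (-1*x≈-x x)) □-x))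

  χ-neg : ∀ {x} → x ≢ 0# → χ (- x) ≡ ℤ.- χ x
  χ-neg {x} x≢0 with isSquare? x
  ... | yes □x =
    trans (χ-nonsquare (-‿≢0 x≢0) (square⇒-nonsquare x≢0 □x)) (cong ℤ.-_ (sym (χ-square x≢0 □x)))
  ... | no ¬□x =
    trans (χ-square (-‿≢0 x≢0) (nonsquare⇒-square x≢0 ¬□x)) (cong ℤ.-_ (sym (χ-nonsquare x≢0 ¬□x)))

module PropertiesOfT {q : ℕ} (q%4≡3 : q % 4 ≡ 3) (F : FiniteField q) where
  open FiniteField F
  open FieldProperties F
  open QuadraticResidues q%4≡3 F
  open CommutativeRing commutativeRing using (-‿inverseʳ; *-comm; *-identityˡ; zeroʳ)
  open IntegerCoefficientSolver commutativeRing
  open ≡-Reasoning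

  ψ-square : ∀ {a b w} → IsSquare w → ψ (a , b) w ≡ a * w
  ψ-square {w = w} □w with isSquare? w
  ... | yes _ = refl
  ... | no ¬□w = ⊥-elim (¬□w □w)

  ψ-nonsquare : ∀ {a b w} → ¬ IsSquare w → ψ (a , b) w ≡ b * w
  ψ-nonsquare {w = w} ¬□w with isSquare? w
  ... | yes □w = ⊥-elim (¬□w □w)
  ... | no _ = refl

  ψ-complement : ∀ a b w → ψ (1# - a , 1# - b) w ≡ w - ψ (a , b) w
  ψ-complement a b w with isSquare? w
  ... | yes _ = solve 2 (λ a w → (:1 :- a) :* w := w :- a :* w) refl a w
  ... | no _ = solve 2 (λ b w → (:1 :- b) :* w := w :- b :* w) refl b w

  ψ-0 : ∀ {ab} → ψ ab 0# ≡ 0#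
  ψ-0 {a , b} with isSquare? 0#
  ... | yes _ = zeroʳ a
  ... | no _ = zeroʳ b

  ψ-flip : ∀ a b w → ψ (b , a) (- w) ≡ - ψ (a , b) w
  ψ-flip a b w with w ≟ 0#
  ... | yes w≡0 = begin
    ψ (b , a) (- w)    ≡⟨ cong (ψ (b , a)) (trans (cong -_ w≡0) ε⁻¹≈ε) ⟩
    ψ (b , a) 0#       ≡⟨ ψ-0 ⟩
    0#                 ≡⟨ ε⁻¹≈ε ⟨
    - 0#               ≡⟨ cong -_ ψ-0 ⟨
    - ψ (a , b) 0#     ≡⟨ cong (λ z → - ψ (a , b) z) w≡0 ⟨
    - ψ (a , b) w      ∎
  ... | no w≢0 with isSquare? w
  ...   | yes □w = trans (ψ-nonsquare (square⇒-nonsquare w≢0 □w)) (sym (-‿distribʳ-* a w))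
  ...   | no ¬□w = trans (ψ-square (nonsquare⇒-square w≢0 ¬□w)) (sym (-‿distribʳ-* b w))

  -- The union of the sets S_{ij}^{rs}: the indices i, j, r, s are determined by (u , v).
  Covered : Pair → Set
  Covered xy = ∃ λ ab → ∃ λ uv → InΣ ab × InE ab uv × Ψ ab ≡ xy

  bit : ∀ w → ∃ λ k → Bit k w
  bit w with isSquare? w
  ... | yes □w = Fin.zero , (λ _ → □w) , (λ _ → refl)
  ... | no ¬□w = Fin.suc Fin.zero , (λ ()) , (λ □w → ⊥-elim (¬□w □w))

  T⇒¬covered : ∀ {xy} → T xy → ¬ Covered xy
  T⇒¬covered (_ , ∉Sᵢⱼʳˢ) (ab , (u , v) , ab∈Σ , uv∈E , Ψab≡xy) =
    ∉Sᵢⱼʳˢ _ _ _ _ (ab , (ab∈Σ , (u , v) , uv∈E , proj₂ (bit u) , proj₂ (bit (- v)) ,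
                          proj₂ (bit (ψ ab u - v)) , proj₂ (bit (u - v - ψ ab (- v)))) , Ψab≡xy)

  uncovered⇒T : ∀ {xy} → InS xy → ¬ Covered xy → T xy
  uncovered⇒T xy∈S ¬covered = xy∈S , λ { _ _ _ _ (ab , (ab∈Σ , uv , uv∈E , _) , Ψab≡xy) →
    ¬covered (ab , uv , ab∈Σ , uv∈E , Ψab≡xy) }

  Σ-complement : ∀ {a b} → InΣ (a , b) → InΣ (1# - a , 1# - b)
  Σ-complement {a} {b} (a≢b , a≢0 , a≢1 , b≢0 , b≢1 , □ab , □[1-a][1-b]) =
    (λ 1-a≡1-b → a≢b (1-‿injective 1-a≡1-b)) , 1-x≢0 a≢1 , 1-x≢1 a≢0 , 1-x≢0 b≢1 , 1-x≢1 b≢0 ,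
    □[1-a][1-b] , subst IsSquare (sym (cong₂ _*_ (1-[1-x]≡x a) (1-[1-x]≡x b))) □ab

  Ψ-complement : ∀ a b → Ψ (1# - a , 1# - b) ≡ swap (Ψ (a , b))
  Ψ-complement a b = cong ((1# - a) * (1# - b) ⁻¹ ,_) (cong₂ (λ c d → c * d ⁻¹) (1-[1-x]≡x a) (1-[1-x]≡x b))

  E-complement : ∀ {a b u v} → InE (a , b) (u , v) → InE (1# - a , 1# - b) (- v , - u)
  E-complement {a} {b} {u} {v} (uv≢0 , ψ-equation) =
    (λ (-v≡0 , -u≡0) → uv≢0 (-x≡0⇒x≡0 -u≡0 , -x≡0⇒x≡0 -v≡0)) , (begin
      ψ′ (ψ′ (- v) - - u)                 ≡⟨ cong (λ z → ψ′ (z - - u)) (ψ-complement a b (- v)) ⟩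
      ψ′ ((- v - Q) - - u)
        ≡⟨ cong ψ′ (solve 3 (λ u v Q → (:- v :- Q) :- (:- u) := u :- v :- Q) refl u v Q) ⟩
      ψ′ (u - v - Q)                      ≡⟨ ψ-complement a b (u - v - Q) ⟩
      u - v - Q - Y
        ≡⟨ solve 5 (λ u v P Q Y → u :- v :- Q :- Y := (u :- P) :+ ((P :- v) :- (Q :+ Y))) refl u v P Q Y ⟩
      (u - P) + ((P - v) - (Q + Y))       ≡⟨ cong (λ z → (u - P) + ((P - v) - z)) ψ-equation ⟨
      (u - P) + ((P - v) - ψ (a , b) (P - v))  ≡⟨ cong₂ _+_ ψ′[--u]≡u-P ψ′[…]≡P-v-… ⟨
      ψ′ (- - u) + ψ′ (- v - - u - ψ′ (- - u)) ∎)
    where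
    ψ′ : Carrier → Carrier
    ψ′ = ψ (1# - a , 1# - b)
    P Q Y : Carrier
    P = ψ (a , b) u
    Q = ψ (a , b) (- v)
    Y = ψ (a , b) (u - v - Q)
    ψ′[--u]≡u-P : ψ′ (- - u) ≡ u - P
    ψ′[--u]≡u-P = trans (cong ψ′ (-‿involutive u)) (ψ-complement a b u)
    ψ′[…]≡P-v-… : ψ′ (- v - - u - ψ′ (- - u)) ≡ (P - v) - ψ (a , b) (P - v)
    ψ′[…]≡P-v-… = begin
      ψ′ (- v - - u - ψ′ (- - u))   ≡⟨ cong (λ z → ψ′ (- v - - u - z)) ψ′[--u]≡u-P ⟩
      ψ′ (- v - - u - (u - P))
        ≡⟨ cong ψ′ (solve 3 (λ u v P → (:- v :- :- u) :- (u :- P) := P :- v) refl u v P) ⟩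
      ψ′ (P - v)                    ≡⟨ ψ-complement a b (P - v) ⟩
      (P - v) - ψ (a , b) (P - v)   ∎

  covered-swap : ∀ {xy} → Covered xy → Covered (swap xy)
  covered-swap ((a , b) , (u , v) , ab∈Σ , uv∈E , Ψab≡xy) =
    (1# - a , 1# - b) , (- v , - u) , Σ-complement ab∈Σ , E-complement uv∈E ,
    trans (Ψ-complement a b) (cong swap Ψab≡xy)

  Σ-flip : ∀ {a b} → InΣ (a , b) → InΣ (b , a)
  Σ-flip {a} {b} (a≢b , a≢0 , a≢1 , b≢0 , b≢1 , □ab , □[1-a][1-b]) =
    (λ b≡a → a≢b (sym b≡a)) , b≢0 , b≢1 , a≢0 , a≢1 ,
    subst IsSquare (*-comm a b) □ab , subst IsSquare (*-comm (1# - a) (1# - b)) □[1-a][1-b]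

  Ψ-flip : ∀ {a b} → InΣ (a , b) → Ψ (b , a) ≡ inv (Ψ (a , b))
  Ψ-flip (_ , a≢0 , a≢1 , b≢0 , b≢1 , _) =
    cong₂ _,_ (sym ([x*y⁻¹]⁻¹≡y*x⁻¹ a≢0 b≢0)) (sym ([x*y⁻¹]⁻¹≡y*x⁻¹ (1-x≢0 a≢1) (1-x≢0 b≢1)))

  E-flip : ∀ {a b u v} → InE (a , b) (u , v) → InE (b , a) (- u , - v)
  E-flip {a} {b} {u} {v} (uv≢0 , ψ-equation) =
    (λ (-u≡0 , -v≡0) → uv≢0 (-x≡0⇒x≡0 -u≡0 , -x≡0⇒x≡0 -v≡0)) , (begin
      ψ′ (ψ′ (- u) - - v)           ≡⟨ cong (λ z → ψ′ (z - - v)) (ψ-flip a b u) ⟩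
      ψ′ (- P - - v)                ≡⟨ cong ψ′ (⁻¹-∙-comm P (- v)) ⟩
      ψ′ (- (P - v))                ≡⟨ ψ-flip a b (P - v) ⟩
      - ψ (a , b) (P - v)           ≡⟨ cong -_ ψ-equation ⟩
      - (Q + Y)                     ≡⟨ ⁻¹-∙-comm Q Y ⟨
      - Q + - Y                     ≡⟨ cong₂ _+_ ψ′[--v]≡-Q ψ′[…]≡-Y ⟨
      ψ′ (- - v) + ψ′ (- u - - v - ψ′ (- - v)) ∎)
    where
    ψ′ : Carrier → Carrier
    ψ′ = ψ (b , a)
    P Q Y : Carrier
    P = ψ (a , b) u
    Q = ψ (a , b) (- v)
    Y = ψ (a , b) (u - v - Q)
    ψ′[--v]≡-Q : ψ′ (- - v) ≡ - Q
    ψ′[--v]≡-Q = ψ-flip a b (- v)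
    ψ′[…]≡-Y : ψ′ (- u - - v - ψ′ (- - v)) ≡ - Y
    ψ′[…]≡-Y = begin
      ψ′ (- u - - v - ψ′ (- - v))   ≡⟨ cong (λ z → ψ′ (- u - - v - z)) ψ′[--v]≡-Q ⟩
      ψ′ (- u - - v - - Q)
        ≡⟨ cong ψ′ (solve 3 (λ u v Q → :- u :- :- v :- :- Q := :- (u :- v :- Q)) refl u v Q) ⟩
      ψ′ (- (u - v - Q))            ≡⟨ ψ-flip a b (u - v - Q) ⟩
      - Y                           ∎

  covered-inv : ∀ {xy} → Covered xy → Covered (inv xy)
  covered-inv ((a , b) , (u , v) , ab∈Σ , uv∈E , Ψab≡xy) =
    (b , a) , (- u , - v) , Σ-flip ab∈Σ , E-flip uv∈E , trans (Ψ-flip ab∈Σ) (cong inv Ψab≡xy)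

  InS-swap : ∀ {x y} → InS (x , y) → InS (y , x)
  InS-swap (□x , □y , x≢y , x≢0 , x≢1 , y≢0 , y≢1) = □y , □x , (λ y≡x → x≢y (sym y≡x)) , y≢0 , y≢1 , x≢0 , x≢1

  InS-inv : ∀ {x y} → InS (x , y) → InS (x ⁻¹ , y ⁻¹)
  InS-inv (□x , □y , x≢y , x≢0 , x≢1 , y≢0 , y≢1) =
    square-⁻¹ x≢0 □x , square-⁻¹ y≢0 □y , (λ x⁻¹≡y⁻¹ → x≢y (⁻¹-injective x≢0 y≢0 x⁻¹≡y⁻¹)) ,
    ⁻¹-≢0 x≢0 , ⁻¹-≢1 x≢0 x≢1 , ⁻¹-≢0 y≢0 , ⁻¹-≢1 y≢0 y≢1
    where
    ⁻¹-≢1 : ∀ {z} → z ≢ 0# → z ≢ 1# → z ⁻¹ ≢ 1#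
    ⁻¹-≢1 z≢0 z≢1 z⁻¹≡1 = z≢1 (⁻¹-injective z≢0 1≢0 (trans z⁻¹≡1 (sym 1⁻¹≡1)))

  inv-involutive : ∀ {xy} → InS xy → inv (inv xy) ≡ xy
  inv-involutive (_ , _ , _ , x≢0 , _ , y≢0 , _) = cong₂ _,_ (⁻¹-involutive x≢0) (⁻¹-involutive y≢0)

  T-swap : ∀ {x y} → T (x , y) → T (y , x)
  T-swap t@(xy∈S , _) = uncovered⇒T (InS-swap xy∈S) (λ yx-covered → T⇒¬covered t (covered-swap yx-covered))

  T-inv : ∀ {x y} → T (x , y) → T (x ⁻¹ , y ⁻¹)
  T-inv t@(xy∈S , _) = uncovered⇒T (InS-inv xy∈S) λ inv-covered →
    T⇒¬covered t (subst Covered (inv-involutive xy∈S) (covered-inv inv-covered))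

  [1,1]∈E : ∀ {a b} → IsSquare b → 1# - a ≢ 0# → IsSquare (1# - a) → InE (a , b) (1# , 1#)
  [1,1]∈E {a} {b} □b 1-a≢0 □1-a = (λ (1≡0 , _) → 1≢0 1≡0) , (begin
    ψ (a , b) (ψ (a , b) 1# - 1#)
      ≡⟨ cong (λ z → ψ (a , b) (z - 1#)) (ψ-square square-1) ⟩
    ψ (a , b) (a * 1# - 1#)
      ≡⟨ ψ-nonsquare ¬□a-1 ⟩
    b * (a * 1# - 1#)
      ≡⟨ solve 2 (λ a b → b :* (a :* :1 :- :1) := b :* :- :1 :+ a :* (:1 :- :1 :- b :* :- :1)) refl a b ⟩
    b * - 1# + a * (1# - 1# - b * - 1#)
      ≡⟨ cong₂ _+_ ψ[-1]≡-b ψ[b]≡ab ⟨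
    ψ (a , b) (- 1#) + ψ (a , b) (1# - 1# - ψ (a , b) (- 1#)) ∎)
    where
    ¬□a-1 : ¬ IsSquare (a * 1# - 1#)
    ¬□a-1 = subst (λ z → ¬ IsSquare z) (solve 1 (λ a → :- (:1 :- a) := a :* :1 :- :1) refl a)
      (square⇒-nonsquare 1-a≢0 □1-a)
    ψ[-1]≡-b : ψ (a , b) (- 1#) ≡ b * - 1#
    ψ[-1]≡-b = ψ-nonsquare -1-nonsquare
    ψ[b]≡ab : ψ (a , b) (1# - 1# - ψ (a , b) (- 1#)) ≡ a * (1# - 1# - b * - 1#)
    ψ[b]≡ab = trans (cong (λ z → ψ (a , b) (1# - 1# - z)) ψ[-1]≡-b)
      (ψ-square (subst IsSquare (solve 1 (λ b → b := :1 :- :1 :- b :* :- :1) refl b) □b))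

  1-[y-1]/[y-x]≡[1-x]/[y-x] : ∀ {x y} → y - x ≢ 0# →
    1# - (y - 1#) * (y - x) ⁻¹ ≡ (1# - x) * (y - x) ⁻¹
  1-[y-1]/[y-x]≡[1-x]/[y-x] {x} {y} y-x≢0 = begin
    1# - (y - 1#) * e
      ≡⟨ cong (λ z → z - (y - 1#) * e) (⁻¹-inverse (y - x) y-x≢0) ⟨
    (y - x) * e - (y - 1#) * e
      ≡⟨ solve 3 (λ x y e → (y :- x) :* e :- (y :- :1) :* e := (:1 :- x) :* e) refl x y e ⟩
    (1# - x) * e                  ∎
    where
    e : Carrier
    e = (y - x) ⁻¹

  1-x[y-1]/[y-x]≡y[1-x]/[y-x] : ∀ {x y} → y - x ≢ 0# →
    1# - x * ((y - 1#) * (y - x) ⁻¹) ≡ y * ((1# - x) * (y - x) ⁻¹)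
  1-x[y-1]/[y-x]≡y[1-x]/[y-x] {x} {y} y-x≢0 = begin
    1# - x * ((y - 1#) * e)
      ≡⟨ cong (λ z → z - x * ((y - 1#) * e)) (⁻¹-inverse (y - x) y-x≢0) ⟨
    (y - x) * e - x * ((y - 1#) * e)
      ≡⟨ solve 3 (λ x y e → (y :- x) :* e :- x :* ((y :- :1) :* e) := y :* ((:1 :- x) :* e)) refl x y e ⟩
    y * ((1# - x) * e)                 ∎
    where
    e : Carrier
    e = (y - x) ⁻¹

  -- The witness is b = (y - 1) / (y - x) and a = x b.
  χ⁺⁺⁻-covered : ∀ {x y} → InS (x , y) →
    χ (y - x) ≡ one → χ (1# - x) ≡ one → χ (1# - y) ≡ minusOne → Covered (x , y)
  χ⁺⁺⁻-covered {x} {y} (□x , □y , _ , x≢0 , x≢1 , y≢0 , y≢1) χ[y-x]≡1 χ[1-x]≡1 χ[1-y]≡-1 =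
    (a , b) , (1# , 1#) , ab∈Σ , [1,1]∈E □b 1-a≢0 □1-a , cong₂ _,_ (x*y*y⁻¹≡x x b≢0) Ψ₂≡y
    where
    y-x≢0 : y - x ≢ 0#
    y-x≢0 = proj₁ (χ≡1⇒square χ[y-x]≡1)
    □d⁻¹ : IsSquare ((y - x) ⁻¹)
    □d⁻¹ = square-⁻¹ y-x≢0 (proj₂ (χ≡1⇒square χ[y-x]≡1))
    □y-1 : IsSquare (y - 1#)
    □y-1 = subst IsSquare (solve 1 (λ y → :- (:1 :- y) := y :- :1) refl y)
      (uncurry nonsquare⇒-square (χ≡-1⇒nonsquare χ[1-y]≡-1))
    b a : Carrier
    b = (y - 1#) * (y - x) ⁻¹
    a = x * b
    1-b≡[1-x]/d : 1# - b ≡ (1# - x) * (y - x) ⁻¹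
    1-b≡[1-x]/d = 1-[y-1]/[y-x]≡[1-x]/[y-x] y-x≢0
    1-a≡y[1-b] : 1# - a ≡ y * (1# - b)
    1-a≡y[1-b] = trans (1-x[y-1]/[y-x]≡y[1-x]/[y-x] y-x≢0) (cong (y *_) (sym 1-b≡[1-x]/d))
    b≢0 : b ≢ 0#
    b≢0 = *-≢0 (λ y-1≡0 → y≢1 (x-y≡0⇒x≡y y-1≡0)) (⁻¹-≢0 y-x≢0)
    1-b≢0 : 1# - b ≢ 0#
    1-b≢0 1-b≡0 = *-≢0 (proj₁ (χ≡1⇒square χ[1-x]≡1)) (⁻¹-≢0 y-x≢0) (trans (sym 1-b≡[1-x]/d) 1-b≡0)
    1-a≢0 : 1# - a ≢ 0#
    1-a≢0 1-a≡0 = *-≢0 y≢0 1-b≢0 (trans (sym 1-a≡y[1-b]) 1-a≡0)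
    □b : IsSquare b
    □b = square-* □y-1 □d⁻¹
    □1-b : IsSquare (1# - b)
    □1-b = subst IsSquare (sym 1-b≡[1-x]/d) (square-* (proj₂ (χ≡1⇒square χ[1-x]≡1)) □d⁻¹)
    □1-a : IsSquare (1# - a)
    □1-a = subst IsSquare (sym 1-a≡y[1-b]) (square-* □y □1-b)
    1-z≢0⇒z≢1 : ∀ {z} → 1# - z ≢ 0# → z ≢ 1#
    1-z≢0⇒z≢1 1-z≢0 z≡1 = 1-z≢0 (trans (cong (λ w → 1# - w) z≡1) (-‿inverseʳ 1#))
    ab∈Σ : InΣ (a , b)
    ab∈Σ = (λ a≡b → x≢1 (*-cancelʳ-≢0 b≢0 (trans a≡b (sym (*-identityˡ b))))) , *-≢0 x≢0 b≢0 ,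
           1-z≢0⇒z≢1 1-a≢0 , b≢0 , 1-z≢0⇒z≢1 1-b≢0 , square-* (square-* □x □b) □b , square-* □1-a □1-b
    Ψ₂≡y : (1# - a) * (1# - b) ⁻¹ ≡ y
    Ψ₂≡y = trans (cong (_* (1# - b) ⁻¹) 1-a≡y[1-b]) (x*y*y⁻¹≡x y 1-b≢0)

  χ-antisym : ∀ {x y} → x ≢ y → χ (x - y) ≡ ℤ.- χ (y - x)
  χ-antisym {x} {y} x≢y = trans (cong χ (sym (⁻¹-anti-homo‿- y x)))
    (χ-neg (λ y-x≡0 → x≢y (sym (x-y≡0⇒x≡y y-x≡0))))

  χ-⁻¹-difference : ∀ {x y} → InS (x , y) → χ (x ⁻¹ - y ⁻¹) ≡ χ (y - x)
  χ-⁻¹-difference {x} {y} (□x , □y , _ , x≢0 , _ , y≢0 , _) = begin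
    χ (x ⁻¹ - y ⁻¹)                ≡⟨ cong χ [y-x]x⁻¹y⁻¹≡x⁻¹-y⁻¹ ⟨
    χ ((y - x) * (x ⁻¹ * y ⁻¹))    ≡⟨ χ-*-square (*-≢0 (⁻¹-≢0 x≢0) (⁻¹-≢0 y≢0)) □x⁻¹y⁻¹ ⟩
    χ (y - x)                      ∎
    where
    □x⁻¹y⁻¹ : IsSquare (x ⁻¹ * y ⁻¹)
    □x⁻¹y⁻¹ = square-* (square-⁻¹ x≢0 □x) (square-⁻¹ y≢0 □y)
    [y-x]x⁻¹y⁻¹≡x⁻¹-y⁻¹ : (y - x) * (x ⁻¹ * y ⁻¹) ≡ x ⁻¹ - y ⁻¹
    [y-x]x⁻¹y⁻¹≡x⁻¹-y⁻¹ = begin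
      (y - x) * (x ⁻¹ * y ⁻¹)
        ≡⟨ solve 4 (λ x y x′ y′ → (y :- x) :* (x′ :* y′) := y :* y′ :* x′ :- x :* x′ :* y′) refl x y (x ⁻¹) (y ⁻¹) ⟩
      y * y ⁻¹ * x ⁻¹ - x * x ⁻¹ * y ⁻¹
        ≡⟨ cong₂ (λ c d → c * x ⁻¹ - d * y ⁻¹) (⁻¹-inverse y y≢0) (⁻¹-inverse x x≢0) ⟩
      1# * x ⁻¹ - 1# * y ⁻¹
        ≡⟨ cong₂ _-_ (*-identityˡ (x ⁻¹)) (*-identityˡ (y ⁻¹)) ⟩
      x ⁻¹ - y ⁻¹                            ∎

  χ-1-⁻¹ : ∀ {x} → x ≢ 0# → IsSquare x → x ≢ 1# → χ (1# - x ⁻¹) ≡ ℤ.- χ (1# - x)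
  χ-1-⁻¹ {x} x≢0 □x x≢1 = begin
    χ (1# - x ⁻¹)               ≡⟨ cong χ -[1-x]x⁻¹≡1-x⁻¹ ⟨
    χ (- (1# - x) * x ⁻¹)       ≡⟨ χ-*-square (⁻¹-≢0 x≢0) (square-⁻¹ x≢0 □x) ⟩
    χ (- (1# - x))              ≡⟨ χ-neg (1-x≢0 x≢1) ⟩
    ℤ.- χ (1# - x)              ∎
    where
    -[1-x]x⁻¹≡1-x⁻¹ : - (1# - x) * x ⁻¹ ≡ 1# - x ⁻¹
    -[1-x]x⁻¹≡1-x⁻¹ = begin
      - (1# - x) * x ⁻¹     ≡⟨ solve 2 (λ x x′ → :- (:1 :- x) :* x′ := x :* x′ :- x′) refl x (x ⁻¹) ⟩
      x * x ⁻¹ - x ⁻¹       ≡⟨ cong (_- x ⁻¹) (⁻¹-inverse x x≢0) ⟩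
      1# - x ⁻¹             ∎

  χ≡1⇒χ≢-1 : ∀ {z} → χ z ≡ one → χ z ≢ minusOne
  χ≡1⇒χ≢-1 χz≡1 χz≡-1 = one≢minusOne (trans (sym χz≡1) χz≡-1)
    where
    one≢minusOne : one ≢ minusOne
    one≢minusOne ()

  T₀-excludes-χ⁺⁻ : ∀ {x y} → T₀ (x , y) → χ (1# - x) ≡ one → χ (1# - y) ≡ minusOne → ⊥
  T₀-excludes-χ⁺⁻ (t@(xy∈S , _) , χ[y-x]≡1) χ[1-x]≡1 χ[1-y]≡-1 =
    T⇒¬covered t (χ⁺⁺⁻-covered xy∈S χ[y-x]≡1 χ[1-x]≡1 χ[1-y]≡-1)

  T-split : DisjointUnion T T₀ T₀′
  T-split = (λ p → split p , [ proj₁ , proj₁ ]) , disjoint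
    where
    split : ∀ p → T p → T₀ p ⊎ T₀′ p
    split (x , y) t@((_ , _ , x≢y , _) , _) with χ-≢0 {y - x} (λ y-x≡0 → x≢y (sym (x-y≡0⇒x≡y y-x≡0)))
    ... | inj₁ χ[y-x]≡1 = inj₁ (t , χ[y-x]≡1)
    ... | inj₂ χ[y-x]≡-1 = inj₂ (t , trans (χ-antisym x≢y) (cong ℤ.-_ χ[y-x]≡-1))
    disjoint : ∀ p → T₀ p → T₀′ p → ⊥
    disjoint (x , y) (((_ , _ , x≢y , _) , _) , χ[y-x]≡1) (_ , χ[x-y]≡1) =
      χ≡1⇒χ≢-1 χ[x-y]≡1 (trans (χ-antisym x≢y) (cong ℤ.-_ χ[y-x]≡1))

  χ-1-x-≢0 : ∀ {x y} → T (x , y) → χ (1# - x) ≡ one ⊎ χ (1# - x) ≡ minusOne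
  χ-1-x-≢0 ((_ , _ , _ , _ , x≢1 , _) , _) = χ-≢0 (1-x≢0 x≢1)

  T₀-split : DisjointUnion T₀ T₁ T₂
  T₀-split = (λ p → split p , [ [ proj₁ , proj₁ ] , proj₁ ]) , disjoint
    where
    split : ∀ p → T₀ p → T₁ p ⊎ T₂ p
    split (x , y) t₀@(t , _) with χ-1-x-≢0 t | χ-1-x-≢0 (T-swap t)
    ... | inj₁ χ[1-x]≡1 | inj₁ χ[1-y]≡1 = inj₁ (inj₁ (t₀ , χ[1-y]≡1 , χ[1-x]≡1))
    ... | inj₁ χ[1-x]≡1 | inj₂ χ[1-y]≡-1 = ⊥-elim (T₀-excludes-χ⁺⁻ t₀ χ[1-x]≡1 χ[1-y]≡-1)
    ... | inj₂ χ[1-x]≡-1 | inj₁ χ[1-y]≡1 = inj₂ (t₀ , χ[1-x]≡-1 , χ[1-y]≡1)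
    ... | inj₂ χ[1-x]≡-1 | inj₂ χ[1-y]≡-1 = inj₁ (inj₂ (t₀ , χ[1-y]≡-1 , χ[1-x]≡-1))
    disjoint : ∀ p → T₁ p → T₂ p → ⊥
    disjoint (x , y) (inj₁ (_ , _ , χ[1-x]≡1)) (_ , χ[1-x]≡-1 , _) = χ≡1⇒χ≢-1 χ[1-x]≡1 χ[1-x]≡-1
    disjoint (x , y) (inj₂ (_ , χ[1-y]≡-1 , _)) (_ , _ , χ[1-y]≡1) = χ≡1⇒χ≢-1 χ[1-y]≡1 χ[1-y]≡-1

  T₀′-split : DisjointUnion T₀′ T₁′ T₂′
  T₀′-split = (λ p → split p , [ [ proj₁ , proj₁ ] , proj₁ ]) , disjoint
    where
    split : ∀ p → T₀′ p → T₁′ p ⊎ T₂′ p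
    split (x , y) t₀′@(t , χ[x-y]≡1) with χ-1-x-≢0 t | χ-1-x-≢0 (T-swap t)
    ... | inj₁ χ[1-x]≡1 | inj₁ χ[1-y]≡1 = inj₁ (inj₁ (t₀′ , χ[1-x]≡1 , χ[1-y]≡1))
    ... | inj₁ χ[1-x]≡1 | inj₂ χ[1-y]≡-1 = inj₂ (t₀′ , χ[1-y]≡-1 , χ[1-x]≡1)
    ... | inj₂ χ[1-x]≡-1 | inj₁ χ[1-y]≡1 = ⊥-elim (T₀-excludes-χ⁺⁻ (T-swap t , χ[x-y]≡1) χ[1-y]≡1 χ[1-x]≡-1)
    ... | inj₂ χ[1-x]≡-1 | inj₂ χ[1-y]≡-1 = inj₁ (inj₂ (t₀′ , χ[1-x]≡-1 , χ[1-y]≡-1))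
    disjoint : ∀ p → T₁′ p → T₂′ p → ⊥
    disjoint (x , y) (inj₁ (_ , _ , χ[1-y]≡1)) (_ , χ[1-y]≡-1 , _) = χ≡1⇒χ≢-1 χ[1-y]≡1 χ[1-y]≡-1
    disjoint (x , y) (inj₂ (_ , χ[1-x]≡-1 , _)) (_ , _ , χ[1-x]≡1) = χ≡1⇒χ≢-1 χ[1-x]≡1 χ[1-x]≡-1

  T₁-split : DisjointUnion T₁ T₁₁ T₁₋₁
  T₁-split = (λ _ → (λ h → h) , (λ h → h)) ,
    λ { (x , y) (_ , χ[1-y]≡1 , _) (_ , χ[1-y]≡-1 , _) → χ≡1⇒χ≢-1 χ[1-y]≡1 χ[1-y]≡-1 }

  T₁′-split : DisjointUnion T₁′ T₁₁′ T₁₋₁′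
  T₁′-split = (λ _ → (λ h → h) , (λ h → h)) ,
    λ { (x , y) (_ , χ[1-x]≡1 , _) (_ , χ[1-x]≡-1 , _) → χ≡1⇒χ≢-1 χ[1-x]≡1 χ[1-x]≡-1 }

  swap-T₀ : ∀ p → T₀ p → T₀′ (swap p)
  swap-T₀ (x , y) (t , χ[y-x]≡1) = T-swap t , χ[y-x]≡1

  swap-T₀′ : ∀ p → T₀′ p → T₀ (swap p)
  swap-T₀′ (x , y) (t , χ[x-y]≡1) = T-swap t , χ[x-y]≡1

  inv-T₀ : ∀ p → T₀ p → T₀′ (inv p)
  inv-T₀ (x , y) (t@(xy∈S , _) , χ[y-x]≡1) = T-inv t , trans (χ-⁻¹-difference xy∈S) χ[y-x]≡1

  inv-T₀′ : ∀ p → T₀′ p → T₀ (inv p)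
  inv-T₀′ (x , y) (t@(xy∈S , _) , χ[x-y]≡1) = T-inv t , trans (χ-⁻¹-difference (InS-swap xy∈S)) χ[x-y]≡1

  χ-1-x⁻¹ : ∀ {x y} → T (x , y) → χ (1# - x ⁻¹) ≡ ℤ.- χ (1# - x)
  χ-1-x⁻¹ ((□x , _ , _ , x≢0 , x≢1 , _) , _) = χ-1-⁻¹ x≢0 □x x≢1

  χ-1-y⁻¹ : ∀ {x y} → T (x , y) → χ (1# - y ⁻¹) ≡ ℤ.- χ (1# - y)
  χ-1-y⁻¹ t = χ-1-x⁻¹ (T-swap t)

  swap-T₁ε : ∀ ε p → T₁ε ε p → T₁ε′ ε (swap p)
  swap-T₁ε ε (x , y) (t₀ , χ[1-y]≡ε , χ[1-x]≡ε) = swap-T₀ (x , y) t₀ , χ[1-y]≡ε , χ[1-x]≡ε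

  swap-T₁ε′ : ∀ ε p → T₁ε′ ε p → T₁ε ε (swap p)
  swap-T₁ε′ ε (x , y) (t₀′ , χ[1-x]≡ε , χ[1-y]≡ε) = swap-T₀′ (x , y) t₀′ , χ[1-x]≡ε , χ[1-y]≡ε

  inv-T₁ε : ∀ ε p → T₁ε ε p → T₁ε′ (ℤ.- ε) (inv p)
  inv-T₁ε ε (x , y) (t₀@(t , _) , χ[1-y]≡ε , χ[1-x]≡ε) =
    inv-T₀ (x , y) t₀ , trans (χ-1-x⁻¹ t) (cong ℤ.-_ χ[1-x]≡ε) , trans (χ-1-y⁻¹ t) (cong ℤ.-_ χ[1-y]≡ε)

  inv-T₁ε′ : ∀ ε p → T₁ε′ ε p → T₁ε (ℤ.- ε) (inv p)
  inv-T₁ε′ ε (x , y) (t₀′@(t , _) , χ[1-x]≡ε , χ[1-y]≡ε) =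
    inv-T₀′ (x , y) t₀′ , trans (χ-1-y⁻¹ t) (cong ℤ.-_ χ[1-y]≡ε) , trans (χ-1-x⁻¹ t) (cong ℤ.-_ χ[1-x]≡ε)

  swap-T₂ : ∀ p → T₂ p → T₂′ (swap p)
  swap-T₂ (x , y) (t₀ , χ[1-x]≡-1 , χ[1-y]≡1) = swap-T₀ (x , y) t₀ , χ[1-x]≡-1 , χ[1-y]≡1

  swap-T₂′ : ∀ p → T₂′ p → T₂ (swap p)
  swap-T₂′ (x , y) (t₀′ , χ[1-y]≡-1 , χ[1-x]≡1) = swap-T₀′ (x , y) t₀′ , χ[1-y]≡-1 , χ[1-x]≡1

  inv-T₂ : ∀ p → T₂ p → T₂′ (inv p)
  inv-T₂ (x , y) (t₀@(t , _) , χ[1-x]≡-1 , χ[1-y]≡1) =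
    inv-T₀ (x , y) t₀ , trans (χ-1-y⁻¹ t) (cong ℤ.-_ χ[1-y]≡1) , trans (χ-1-x⁻¹ t) (cong ℤ.-_ χ[1-x]≡-1)

  inv-T₂′ : ∀ p → T₂′ p → T₂ (inv p)
  inv-T₂′ (x , y) (t₀′@(t , _) , χ[1-y]≡-1 , χ[1-x]≡1) =
    inv-T₀′ (x , y) t₀′ , trans (χ-1-x⁻¹ t) (cong ℤ.-_ χ[1-x]≡1) , trans (χ-1-y⁻¹ t) (cong ℤ.-_ χ[1-y]≡-1)

  inv²≡id-on-T : ∀ p → T p → inv (inv p) ≡ p
  inv²≡id-on-T p (p∈S , _) = inv-involutive p∈S

  swap-permutes-T : Permutes swap T
  swap-permutes-T = involution-permutes swap (λ _ → T-swap) (λ _ _ → refl)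

  inv-permutes-T : Permutes inv T
  inv-permutes-T = involution-permutes inv (λ _ → T-inv) inv²≡id-on-T

  swap-exchanges-T₁ : Exchanges swap T₁ T₁′
  swap-exchanges-T₁ = involution-exchanges swap
    (λ p → Sum.map (swap-T₁ε one p) (swap-T₁ε minusOne p))
    (λ p → Sum.map (swap-T₁ε′ one p) (swap-T₁ε′ minusOne p))
    (λ _ _ → refl) (λ _ _ → refl)

  swap-exchanges-T₂ : Exchanges swap T₂ T₂′
  swap-exchanges-T₂ = involution-exchanges swap swap-T₂ swap-T₂′ (λ _ _ → refl) (λ _ _ → refl)

  inv-exchanges-T₁ : Exchanges inv T₁ T₁′
  inv-exchanges-T₁ = involution-exchanges inv
    (λ p → Sum.swap ∘ Sum.map (inv-T₁ε one p) (inv-T₁ε minusOne p))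
    (λ p → Sum.swap ∘ Sum.map (inv-T₁ε′ one p) (inv-T₁ε′ minusOne p))
    (λ p → [ inv²≡id-on-T p ∘ proj₁ ∘ proj₁ , inv²≡id-on-T p ∘ proj₁ ∘ proj₁ ])
    (λ p → [ inv²≡id-on-T p ∘ proj₁ ∘ proj₁ , inv²≡id-on-T p ∘ proj₁ ∘ proj₁ ])

  inv-exchanges-T₂ : Exchanges inv T₂ T₂′
  inv-exchanges-T₂ = involution-exchanges inv inv-T₂ inv-T₂′
    (λ p → inv²≡id-on-T p ∘ proj₁ ∘ proj₁) (λ p → inv²≡id-on-T p ∘ proj₁ ∘ proj₁)

  swap-maps-T₁ε : ∀ ε → MapsOnto swap (T₁ε ε) (T₁ε′ ε)
  swap-maps-T₁ε ε = involution-mapsOnto swap (swap-T₁ε ε) (swap-T₁ε′ ε) (λ _ _ → refl)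

  inv-maps-T₁ε : ∀ ε → MapsOnto inv (T₁ε ε) (T₁ε′ (ℤ.- ε))
  inv-maps-T₁ε ε = involution-mapsOnto inv (inv-T₁ε ε)
    (λ p h → subst (λ ε′ → T₁ε ε′ (inv p)) (ℤ.neg-involutive ε) (inv-T₁ε′ (ℤ.- ε) p h))
    (λ p → inv²≡id-on-T p ∘ proj₁ ∘ proj₁)

lemma4p1 : (q : ℕ) → IsPrimePower q → q % 4 ≡ 3 → (F : FiniteField q) →
    let open FiniteField F in
      DisjointUnion T T₀ T₀′
    × DisjointUnion T₀ T₁ T₂
    × DisjointUnion T₀′ T₁′ T₂′
    × DisjointUnion T₁ T₁₁ T₁₋₁
    × DisjointUnion T₁′ T₁₁′ T₁₋₁′
    × Permutes swap T × Permutes inv T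
    × Exchanges swap T₁ T₁′ × Exchanges swap T₂ T₂′
    × Exchanges inv T₁ T₁′ × Exchanges inv T₂ T₂′
    × (∀ (ε : ℤ) → (ε ≡ + 1 ⊎ ε ≡ -[1+ 0 ]) →
         MapsOnto swap (T₁ε ε) (T₁ε′ ε)
       × MapsOnto inv (T₁ε ε) (T₁ε′ (Data.Integer.- ε)))
lemma4p1 q _ q%4≡3 F =
  T-split , T₀-split , T₀′-split , T₁-split , T₁′-split ,
  swap-permutes-T , inv-permutes-T ,
  swap-exchanges-T₁ , swap-exchanges-T₂ , inv-exchanges-T₁ , inv-exchanges-T₂ ,
  λ ε _ → swap-maps-T₁ε ε , inv-maps-T₁ε ε
  where open PropertiesOfT q%4≡3 F
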